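{- Let $P$ be a finite bounded poset admitting a recursive first atom set $\Omega$, and let $\mathcal{M}_\Omega$ be the set of maximal chains of $P$ partially ordered by $\preceq$. Then any linear extension of $\mathcal{M}_\Omega$ gives a shelling order of the order complex $\Delta(P)$.
   Context: A poset is bounded if it has a unique minimum $\hat 0$ and maximum $\hat 1$; $x\lessdot y$ denotes a cover relation; the length of $P$ is the length of its longest chain. The order complex $\Delta(P)$ is the simplicial complex whose faces are the chains of $P$; its facets are the maximal chains. An ordering $F_1,\dots,F_s$ of the facets of a simplicial complex is a shelling order if for each $1<j\le s$, $\overline{F_j}\cap\bigl(\bigcup_{i<j}\overline{F_i}\bigr)$ is pure of dimension $\dim F_j-1$. A root of $x$ is a maximal chain of $[\hat0,x]$; a rooted interval $[x,y]_r$ is an interval with a root $r$ of $x$. For a chain $m$ containing $x$, $m^x=\{w\in m:w\le x\}$; $r\cup a$ means $r\cup\{a\}$. RFAS: $P$ admits a recursive first atom set if $P$ has length 1, or if for each $x<y$ in $P$ and each root $r$ of $x$ there is an atom $\Omega(r,x,y)$ of $[x,y]$ such that, whenever $a$ is an atom of $[x,y]$ with $a<y$ and $b=\Omega(r\cup a,a,y)$: (i) $a=\Omega(r,x,y)$ iff $a=\Omega(r,x,b)$; (ii) if $a\ne\Omega(r,x,y)=:a'$, there exist atoms $a_1,\dots,a_p$ of $[x,y]$ and elements $b_1,\dots,b_{p-1}$ with $a_p=\Omega(r,x,b)$, $a_1=a'$, and for all $1\le i\le p-1$, $b_i=\Omega(r\cup a_{i+1},a_{i+1},y)$ and $a_i=\Omega(r,x,b_i)$.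 The first atom chain $c(r,x,y)$ is the unique maximal chain $x=z_0\lessdot z_1\lessdot\cdots\lessdot z_q=y$ of $[x,y]$ with $z_{i+1}=\Omega(r\cup\{z_1,\dots,z_i\},z_i,y)$ for $0\le i\le q-2$. For a maximal chain $m:\hat0=x_0\lessdot\cdots\lessdot x_n=\hat1$ of $P$, $x_i\lessdot x_{i+1}\lessdot x_{i+2}$ is a pseudo descent of $m$ if $x_{i+1}\ne\Omega(m^{x_i},x_i,x_{i+2})$. For maximal chains $m,m'$ of $P$, $m\to m'$ means there are $x\lessdot y\lessdot z$ with $x,z\in m\cap m'$, $m$ and $m'$ agree below $x$ and above $z$, $x\lessdot y\lessdot z$ is a pseudo descent of $m'$, and the portion of $m$ between $x$ and $z$ is $c(m^x,x,z)$. $\preceq$ is the reflexive and transitive closure of all relations $m\to m'$ (it is a partial order on the set of maximal chains). -}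

module Defs where

open import Data.Nat as ℕ using (ℕ; zero; suc)
open import Data.Fin as Fin using (Fin; zero; suc; fromℕ; inject₁; toℕ)
open import Data.Fin.Subset using (Subset; _∈_; _⊆_; _∪_; ⁅_⁆; ∣_∣)
open import Data.Bool using (Bool; _∧_)
open import Data.Vec using (tabulate; lookup)
open import Data.Product using (Σ; ∃; ∃-syntax; _×_; _,_)
open import Data.Sum using (_⊎_)
open import Data.Empty using (⊥)
open import Relation.Nullary using (¬_; does)
open import Relation.Binary using (Decidable; IsPartialOrder)
open import Relation.Binary.PropositionalEquality using (_≡_; _≢_)
open import Relation.Binary.Construct.Closure.ReflexiveTransitive using (Star)
open import Function.Bundles using (_⇔_)

-- A finite bounded poset, with carrier Fin n (any finite poset is isomorphic
-- to one of this form).  The order is decidable (automatic classically for a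
-- finite poset; needed to form subsets such as m^x).
record FinBoundedPoset (n : ℕ) : Set₁ where
  field
    _≤_            : Fin n → Fin n → Set
    _≤?_           : Decidable _≤_
    isPartialOrder : IsPartialOrder _≡_ _≤_
    0̂ 1̂            : Fin n
    0̂-min          : ∀ x → 0̂ ≤ x
    1̂-max          : ∀ x → x ≤ 1̂

module _ {n : ℕ} (P : FinBoundedPoset n) where
  open FinBoundedPoset P

  _<ₚ_ : Fin n → Fin n → Set
  x <ₚ y = x ≤ y × x ≢ y

  _⋖_ : Fin n → Fin n → Set
  x ⋖ y = x <ₚ y × (∀ z → x <ₚ z → z <ₚ y → ⊥)

  IsAtom : Fin n → Fin n → Fin n → Set
  IsAtom x y a = x ⋖ a × a ≤ y

  -- chains (= faces of the order complex Δ(P)), as subsets of P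
  IsChain : Subset n → Set
  IsChain s = ∀ {a b} → a ∈ s → b ∈ s → (a ≤ b ⊎ b ≤ a)

  InInterval : Fin n → Fin n → Subset n → Set
  InInterval x y s = ∀ {w} → w ∈ s → (x ≤ w × w ≤ y)

  IsMaxChainIn : Fin n → Fin n → Subset n → Set
  IsMaxChainIn x y s =
    IsChain s × InInterval x y s ×
    (∀ t → IsChain t → InInterval x y t → s ⊆ t → t ⊆ s)

  IsMaxChain : Subset n → Set
  IsMaxChain = IsMaxChainIn 0̂ 1̂

  IsRoot : Fin n → Subset n → Set
  IsRoot x r = IsMaxChainIn 0̂ x r

  HasLength : ℕ → Set
  HasLength k = (∃[ s ] (IsChain s × ∣ s ∣ ≡ suc k))
              × (∀ s → IsChain s → ∣ s ∣ ℕ.≤ suc k)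

  -- m^x = { w ∈ m : w ≤ x }
  below : Subset n → Fin n → Subset n
  below m x = tabulate λ w → lookup m w ∧ does (w ≤? x)

  above : Subset n → Fin n → Subset n
  above m z = tabulate λ w → lookup m w ∧ does (z ≤? w)

  between : Subset n → Fin n → Fin n → Subset n
  between m x z = tabulate λ w → lookup m w ∧ (does (x ≤? w) ∧ does (w ≤? z))

  module _ (Ω : Subset n → Fin n → Fin n → Fin n) where

    -- condition (ii): the sequence a_1..a_p (indices 0..q, p = q+1)
    -- and b_1..b_{p-1} (indices 0..q-1)
    RFASChain : Subset n → Fin n → Fin n → Fin n → Set
    RFASChain r x y b =
      ∃[ q ] Σ (Fin (suc q) → Fin n) λ as → Σ (Fin q → Fin n) λ bs →
        (∀ j → IsAtom x y (as j))
        × as (fromℕ q) ≡ Ω r x b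
        × as zero ≡ Ω r x y
        × (∀ i → bs i ≡ Ω (r ∪ ⁅ as (suc i) ⁆) (as (suc i)) y
                 × as (inject₁ i) ≡ Ω r x (bs i))

    RFASCondition : Set
    RFASCondition =
      ∀ x y r → x <ₚ y → IsRoot x r →
        IsAtom x y (Ω r x y)
        × (∀ a → IsAtom x y a → a <ₚ y →
             ((a ≡ Ω r x y) ⇔ (a ≡ Ω r x (Ω (r ∪ ⁅ a ⁆) a y)))
             × (a ≢ Ω r x y → RFASChain r x y (Ω (r ∪ ⁅ a ⁆) a y)))

    IsRFAS : Set
    IsRFAS = HasLength 1 ⊎ RFASCondition

    -- c is the first atom chain c(r,x,y): a maximal chain of [x,y] whose
    -- consecutive elements z ⋖ w with w ≠ y satisfy
    -- w = Ω(r ∪ {z_1,…,z_i}, z, y), where {x=z_0,…,z_i=z} = c^z.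
    IsFirstAtomChain : Subset n → Fin n → Fin n → Subset n → Set
    IsFirstAtomChain r x y c =
      IsMaxChainIn x y c ×
      (∀ {z w} → z ∈ c → w ∈ c → z ⋖ w → w <ₚ y →
         w ≡ Ω (r ∪ below c z) z y)

    IsPseudoDescent : Subset n → Fin n → Fin n → Fin n → Set
    IsPseudoDescent m x y z =
      x ∈ m × y ∈ m × z ∈ m × x ⋖ y × y ⋖ z × y ≢ Ω (below m x) x z

    _⟶_ : Subset n → Subset n → Set
    m ⟶ m' =
      IsMaxChain m × IsMaxChain m' ×
      ∃[ x ] ∃[ y ] ∃[ z ]
        (x ∈ m × z ∈ m
         × below m x ≡ below m' x
         × above m z ≡ above m' z
         × IsPseudoDescent m' x y z
         × IsFirstAtomChain (below m x) x z (between m x z))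

    _⪯_ : Subset n → Subset n → Set
    _⪯_ = Star _⟶_

    IsLinearExtension : (s : ℕ) → (Fin s → Subset n) → Set
    IsLinearExtension s F =
      (∀ i → IsMaxChain (F i))
      × (∀ m → IsMaxChain m → ∃[ i ] F i ≡ m)
      × (∀ i j → F i ≡ F j → i ≡ j)
      × (∀ i j → F i ⪯ F j → i Fin.≤ j)

-- A simplicial complex given by a predicate on faces is pure of dimension
-- N-1 (N = number of vertices of a maximal face): every maximal face has N vertices.
IsPureOfSize : {n : ℕ} → (Subset n → Set) → ℕ → Set
IsPureOfSize {n} K N =
  ∀ G → K G → (∀ H → K H → G ⊆ H → H ⊆ G) → ∣ G ∣ ≡ N

-- F_0,…,F_{s-1} is a shelling order: for j>0 (paper's j>1),
-- ⟨F_j⟩ ∩ ⋃_{i<j} ⟨F_i⟩ is pure of dimension dim F_j - 1,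
-- i.e. its maximal faces have |F_j| - 1 vertices.
IsShellingOrder : {n s : ℕ} → (Fin s → Subset n) → Set
IsShellingOrder {n} {s} F =
  ∀ j → 0 ℕ.< toℕ j →
    IsPureOfSize (λ G → G ⊆ F j × ∃[ i ] (i Fin.< j × G ⊆ F i))
                 (ℕ.pred ∣ F j ∣)

module Submission where

-- If x ⋖ y ⋖ z is a pseudo descent of a maximal chain m, replacing y by the first atom
-- chain c(m^x, x, z) gives a chain m″ → m that keeps every element of m except y.  Conversely,
-- if m ⋠ m′ then m has a pseudo descent whose middle element is missing from m′: walk up along
-- the common elements of m and m′; a segment of m between consecutive common elements is either
-- a first atom chain, which may be spliced into m′ staying ⪯ m′ (this is where the RFAS axioms
-- are used), or contains a pseudo descent.  So for i < j the facet F j has a vertex y ∉ F i with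
-- F j − y contained in an earlier facet, which is a reformulation of the shelling condition.

open import Defs hiding (_<ₚ_; _⋖_; IsChain; InInterval; IsMaxChainIn; IsMaxChain; IsRoot; below; above; between; IsFirstAtomChain; IsPseudoDescent; _⟶_; _⪯_)
open import Data.Nat using (ℕ; suc)
open import Data.Fin using (Fin)
open import Data.Fin.Subset using (Subset)

import Data.Nat as ℕ
import Data.Nat.Properties as ℕ
open import Data.Nat.Induction using (<-wellFounded)
open import Data.Fin as Fin using (zero; suc; fromℕ; inject₁; toℕ; _≟_)
open import Data.Fin.Properties using (≤∧≢⇒<)
open import Data.Fin.Induction using (<-weakInduction)
open import Data.Fin.Subset using (⊤; _∈_; _∉_; _⊆_; _⊂_; _∪_; ⁅_⁆; ∣_∣; _-_; inside; outside)
open import Data.Fin.Subset.Properties using (x∈p∪q⁺; x∈p∪q⁻; x∈⁅x⁆; x∈⁅y⁆⇒x≡y; ⊆-antisym; _∈?_; p⊂q⇒∣p∣<∣q∣; p⊆q⇒∣p∣≤∣q∣; p─⊥≡p; p─q⊆p; x∈p∧x≢y⇒x∈p-y; ∣⁅x⁆∣≡1; ∈⊤)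
open import Data.Bool using (true; false; _∧_)
open import Data.Vec using (tabulate; lookup; _∷_; here; there)
open import Data.Vec.Properties using (lookup∘tabulate; []=⇒lookup; lookup⇒[]=)
open import Data.List using (List; []; _∷_; allFin)
open import Data.List.Relation.Unary.All as All using (All; []; _∷_)
open import Data.List.Membership.Propositional.Properties using (∈-allFin)
open import Data.Product using (Σ; ∃-syntax; _×_; _,_; proj₁; proj₂)
open import Data.Sum as Sum using (_⊎_; inj₁; inj₂; [_,_])
open import Data.Empty using (⊥; ⊥-elim)
open import Function using (_∘_; flip; id)
open import Function.Bundles using (Equivalence)
open import Induction.WellFounded as WF using (WellFounded)
open import Relation.Nullary using (¬_; does; Dec; yes; no)
open import Relation.Nullary.Decidable using (dec-true; _×-dec_)
open import Relation.Binary using (IsPartialOrder; Decidable)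
open import Relation.Binary.PropositionalEquality using (_≡_; _≢_; refl; sym; trans; cong; cong₂; subst; subst₂; resp₂; module ≡-Reasoning)
open import Relation.Binary.Construct.Closure.ReflexiveTransitive using (ε; _◅_; _◅◅_)
import Relation.Binary.Construct.On as On
import Relation.Binary.Construct.NonStrictToStrict as NonStrictToStrict

module _ {n : ℕ} where

  -- Defs.below, Defs.above and Defs.between are, definitionally, restrict m of an order predicate.
  restrict : {Q : Fin n → Set} → Subset n → (∀ w → Dec (Q w)) → Subset n
  restrict m Q? = tabulate λ w → lookup m w ∧ does (Q? w)

  ∈-restrict⁻ : ∀ {Q : Fin n → Set} {m w} (Q? : ∀ w → Dec (Q w)) → w ∈ restrict m Q? → w ∈ m × Q w
  ∈-restrict⁻ {m = m} {w} Q? h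
    with lookup m w in m[w] | Q? w | trans (sym (lookup∘tabulate _ w)) ([]=⇒lookup h)
  ... | true  | yes q | _ = lookup⇒[]= w m m[w] , q
  ... | true  | no _  | ()
  ... | false | _     | ()

  ∈-restrict⁺ : ∀ {Q : Fin n → Set} {m w} (Q? : ∀ w → Dec (Q w)) → w ∈ m → Q w → w ∈ restrict m Q?
  ∈-restrict⁺ {m = m} {w} Q? h q =
    lookup⇒[]= w _ (trans (lookup∘tabulate _ w) (cong₂ _∧_ ([]=⇒lookup h) (dec-true (Q? w) q)))

  ∈-∪⁻ : ∀ {p q : Subset n} {w} → w ∈ p ∪ q → w ∈ p ⊎ w ∈ q
  ∈-∪⁻ = x∈p∪q⁻ _ _

  ∈-∪ˡ : ∀ {p q : Subset n} {w} → w ∈ p → w ∈ p ∪ q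
  ∈-∪ˡ = x∈p∪q⁺ ∘ inj₁

  ∈-∪ʳ : ∀ {p q : Subset n} {w} → w ∈ q → w ∈ p ∪ q
  ∈-∪ʳ = x∈p∪q⁺ ∘ inj₂

  ∈-insert⁻ : ∀ {p : Subset n} {e w} → w ∈ p ∪ ⁅ e ⁆ → w ∈ p ⊎ w ≡ e
  ∈-insert⁻ w∈ = Sum.map₂ (x∈⁅y⁆⇒x≡y _) (∈-∪⁻ w∈)

x∉p-x : ∀ {n} {p : Subset n} {x : Fin n} → x ∉ p - x
x∉p-x {p = _ ∷ _} {zero}  ()
x∉p-x {p = _ ∷ p} {suc x} (there h) = x∉p-x {p = p} h

x∈p⇒∣p∣≡suc∣p-x∣ : ∀ {n} {p : Subset n} {x : Fin n} → x ∈ p → ∣ p ∣ ≡ suc ∣ p - x ∣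
x∈p⇒∣p∣≡suc∣p-x∣ {p = inside  ∷ p} {zero}  here      = cong (suc ∘ ∣_∣) (sym (p─⊥≡p p))
x∈p⇒∣p∣≡suc∣p-x∣ {p = inside  ∷ p} {suc x} (there h) = cong suc (x∈p⇒∣p∣≡suc∣p-x∣ h)
x∈p⇒∣p∣≡suc∣p-x∣ {p = outside ∷ p} {suc x} (there h) = x∈p⇒∣p∣≡suc∣p-x∣ h

shelling-criterion : ∀ {n s} (F : Fin s → Subset n) →
                     (∀ {i j} → i Fin.< j → ∃[ y ] y ∈ F j × y ∉ F i × ∃[ k ] k Fin.< j × F j - y ⊆ F k) →
                     IsShellingOrder F
shelling-criterion F exchange j _ G (G⊆Fj , i , i<j , G⊆Fi) G-maximal with exchange i<j
... | y , y∈Fj , y∉Fi , k , k<j , Fj-y⊆Fk = begin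
  ∣ G ∣             ≡⟨ cong ∣_∣ G≡Fj-y ⟩
  ∣ F j - y ∣       ≡⟨ cong ℕ.pred (x∈p⇒∣p∣≡suc∣p-x∣ y∈Fj) ⟨
  ℕ.pred ∣ F j ∣    ∎
  where
  open ≡-Reasoning
  G⊆Fj-y : G ⊆ F j - y
  G⊆Fj-y w∈ = x∈p∧x≢y⇒x∈p-y (G⊆Fj w∈) (λ { refl → y∉Fi (G⊆Fi w∈) })
  G≡Fj-y : G ≡ F j - y
  G≡Fj-y = ⊆-antisym G⊆Fj-y (G-maximal (F j - y) (p─q⊆p (F j) ⁅ y ⁆ , k , k<j , Fj-y⊆Fk) G⊆Fj-y)

module Poset {n : ℕ} (P : FinBoundedPoset n) where
  open FinBoundedPoset P public
  open IsPartialOrder isPartialOrder public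
    using (antisym) renaming (refl to ≤-refl; trans to ≤-trans)

  infix 4 _<ₚ_ _⋖_

  _<ₚ_ : Fin n → Fin n → Set
  _<ₚ_ = Defs._<ₚ_ P

  _⋖_ : Fin n → Fin n → Set
  _⋖_ = Defs._⋖_ P

  IsChain : Subset n → Set
  IsChain = Defs.IsChain P

  InInterval : Fin n → Fin n → Subset n → Set
  InInterval = Defs.InInterval P

  IsMaxChainIn : Fin n → Fin n → Subset n → Set
  IsMaxChainIn = Defs.IsMaxChainIn P

  IsMaxChain : Subset n → Set
  IsMaxChain = Defs.IsMaxChain P

  IsRoot : Fin n → Subset n → Set
  IsRoot = Defs.IsRoot P

  below above : Subset n → Fin n → Subset n
  below = Defs.below P
  above = Defs.above P

  between : Subset n → Fin n → Fin n → Subset n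
  between = Defs.between P

  private
    module Strict = NonStrictToStrict _≡_ _≤_

  <⇒≤ : ∀ {x y} → x <ₚ y → x ≤ y
  <⇒≤ = proj₁

  <⇒≢ : ∀ {x y} → x <ₚ y → x ≢ y
  <⇒≢ = proj₂

  <⇒≱ : ∀ {x y} → x <ₚ y → ¬ (y ≤ x)
  <⇒≱ = Strict.<⇒≱ antisym

  <-trans : ∀ {x y z} → x <ₚ y → y <ₚ z → x <ₚ z
  <-trans = Strict.<-trans isPartialOrder

  <-≤-trans : ∀ {x y z} → x <ₚ y → y ≤ z → x <ₚ z
  <-≤-trans = Strict.<-≤-trans sym ≤-trans antisym (proj₁ (resp₂ _≤_))

  ≤-<-trans : ∀ {x y z} → x ≤ y → y <ₚ z → x <ₚ z
  ≤-<-trans = Strict.≤-<-trans ≤-trans antisym (proj₂ (resp₂ _≤_))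

  _<?_ : Decidable _<ₚ_
  _<?_ = Strict.<-decidable _≟_ _≤?_

  ≤⇒≡⊎< : ∀ {x y} → x ≤ y → x ≡ y ⊎ x <ₚ y
  ≤⇒≡⊎< {x} {y} x≤y with x ≟ y
  ... | yes x≡y = inj₁ x≡y
  ... | no  x≢y = inj₂ (x≤y , x≢y)

  ⋖⇒< : ∀ {x y} → x ⋖ y → x <ₚ y
  ⋖⇒< = proj₁

  ⋖⇒≤ : ∀ {x y} → x ⋖ y → x ≤ y
  ⋖⇒≤ = proj₁ ∘ proj₁

  ⋖-between : ∀ {x y e} → x ⋖ y → x ≤ e → e ≤ y → e ≡ x ⊎ e ≡ y
  ⋖-between {x} {y} {e} (_ , nothing-between) x≤e e≤y with e ≟ x | e ≟ y
  ... | yes e≡x | _       = inj₁ e≡x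
  ... | no  _   | yes e≡y = inj₂ e≡y
  ... | no  e≢x | no  e≢y = ⊥-elim (nothing-between e (x≤e , e≢x ∘ sym) (e≤y , e≢y))

  ⋖-unique-below : ∀ {x y a} → x ⋖ y → x ⋖ a → a ≤ y → a ≡ y
  ⋖-unique-below x⋖y x⋖a a≤y with ⋖-between x⋖y (⋖⇒≤ x⋖a) a≤y
  ... | inj₁ a≡x = ⊥-elim (<⇒≢ (⋖⇒< x⋖a) (sym a≡x))
  ... | inj₂ a≡y = a≡y

  ∈-below⁻ : ∀ m {x w} → w ∈ below m x → w ∈ m × w ≤ x
  ∈-below⁻ m {x = x} = ∈-restrict⁻ {m = m} (_≤? x)

  ∈-below⁺ : ∀ {m x w} → w ∈ m → w ≤ x → w ∈ below m x
  ∈-below⁺ {x = x} = ∈-restrict⁺ (_≤? x)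

  ∈-above⁻ : ∀ m {x w} → w ∈ above m x → w ∈ m × x ≤ w
  ∈-above⁻ m {x = x} = ∈-restrict⁻ {m = m} (x ≤?_)

  ∈-above⁺ : ∀ {m x w} → w ∈ m → x ≤ w → w ∈ above m x
  ∈-above⁺ {x = x} = ∈-restrict⁺ (x ≤?_)

  ∈-between⁻ : ∀ m {x z w} → w ∈ between m x z → w ∈ m × x ≤ w × w ≤ z
  ∈-between⁻ m {x = x} {z} = ∈-restrict⁻ {m = m} (λ w → (x ≤? w) ×-dec (w ≤? z))

  ∈-between⁺ : ∀ {m x z w} → w ∈ m → x ≤ w → w ≤ z → w ∈ between m x z
  ∈-between⁺ {x = x} {z} w∈m x≤w w≤z = ∈-restrict⁺ (λ w → (x ≤? w) ×-dec (w ≤? z)) w∈m (x≤w , w≤z)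

  upset : Fin n → Subset n
  upset x = restrict ⊤ (x ≤?_)

  <⇒upset-shrinks : ∀ {x y} → x <ₚ y → ∣ upset y ∣ ℕ.< ∣ upset x ∣
  <⇒upset-shrinks {x} {y} x<y = p⊂q⇒∣p∣<∣q∣ (upset-y⊆upset-x , x , x∈upset-x , x∉upset-y)
    where
    upset-y⊆upset-x : upset y ⊆ upset x
    upset-y⊆upset-x w∈ = ∈-restrict⁺ (x ≤?_) ∈⊤ (≤-trans (<⇒≤ x<y) (proj₂ (∈-restrict⁻ {m = ⊤} (y ≤?_) w∈)))
    x∈upset-x : x ∈ upset x
    x∈upset-x = ∈-restrict⁺ (x ≤?_) ∈⊤ ≤-refl
    x∉upset-y : x ∉ upset y
    x∉upset-y x∈ = <⇒≱ x<y (proj₂ (∈-restrict⁻ {m = ⊤} (y ≤?_) x∈))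

  >-wellFounded : WellFounded (flip _<ₚ_)
  >-wellFounded = WF.Subrelation.wellFounded <⇒upset-shrinks (On.wellFounded (∣_∣ ∘ upset) <-wellFounded)

  upward-induction : (Q : Fin n → Set) → (∀ x → (∀ {y} → x <ₚ y → Q y) → Q x) → ∀ x → Q x
  upward-induction = WF.All.wfRec >-wellFounded _

  module _ {Q : Fin n → Set} (Q? : ∀ w → Dec (Q w))
           (comparable : ∀ {e f} → Q e → Q f → e ≤ f ⊎ f ≤ e) where

    private
      least-of : ∀ e₀ → Q e₀ → (fs : List (Fin n)) → Σ (Fin n) λ e → Q e × All (λ f → Q f → e ≤ f) fs
      least-of e₀ q₀ [] = e₀ , q₀ , []
      least-of e₀ q₀ (f ∷ fs) with least-of e₀ q₀ fs | Q? f
      ... | e , qe , e≤fs | no ¬qf = e , qe , (λ qf → ⊥-elim (¬qf qf)) ∷ e≤fs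
      ... | e , qe , e≤fs | yes qf with comparable qe qf
      ...   | inj₁ e≤f = e , qe , (λ _ → e≤f) ∷ e≤fs
      ...   | inj₂ f≤e = f , qf , (λ _ → ≤-refl) ∷ All.map (λ e≤g qg → ≤-trans f≤e (e≤g qg)) e≤fs

    least : ∀ e₀ → Q e₀ → Σ (Fin n) λ e → Q e × (∀ f → Q f → e ≤ f)
    least e₀ q₀ with least-of e₀ q₀ (allFin n)
    ... | e , qe , e≤all = e , qe , λ f → All.lookup e≤all (∈-allFin f)

module Chains {n : ℕ} (P : FinBoundedPoset n) where
  open Poset P public

  insert-comparable : ∀ {x y s e} → IsMaxChainIn x y s → x ≤ e → e ≤ y →
                      (∀ {w} → w ∈ s → w ≤ e ⊎ e ≤ w) → e ∈ s
  insert-comparable {x} {y} {s} {e} (chain , within , maximal) x≤e e≤y comparable =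
    maximal (s ∪ ⁅ e ⁆) chain′ within′ ∈-∪ˡ (∈-∪ʳ (x∈⁅x⁆ e))
    where
    chain′ : IsChain (s ∪ ⁅ e ⁆)
    chain′ a∈ b∈ with ∈-insert⁻ a∈ | ∈-insert⁻ b∈
    ... | inj₁ a∈s | inj₁ b∈s = chain a∈s b∈s
    ... | inj₁ a∈s | inj₂ refl = comparable a∈s
    ... | inj₂ refl | inj₁ b∈s = [ inj₂ , inj₁ ] (comparable b∈s)
    ... | inj₂ refl | inj₂ refl = inj₁ ≤-refl
    within′ : InInterval x y (s ∪ ⁅ e ⁆)
    within′ w∈ with ∈-insert⁻ w∈
    ... | inj₁ w∈s = within w∈s
    ... | inj₂ refl = x≤e , e≤y

  bottom∈ : ∀ {x y s} → IsMaxChainIn x y s → x ≤ y → x ∈ s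
  bottom∈ c@(_ , within , _) x≤y = insert-comparable c ≤-refl x≤y (inj₂ ∘ proj₁ ∘ within)

  top∈ : ∀ {x y s} → IsMaxChainIn x y s → x ≤ y → y ∈ s
  top∈ c@(_ , within , _) x≤y = insert-comparable c x≤y ≤-refl (inj₁ ∘ proj₂ ∘ within)

  0̂∈ : ∀ {m} → IsMaxChain m → 0̂ ∈ m
  0̂∈ c = bottom∈ c (0̂-min 1̂)

  1̂∈ : ∀ {m} → IsMaxChain m → 1̂ ∈ m
  1̂∈ c = top∈ c (0̂-min 1̂)

  chain-⋖-split : ∀ {m u a e} → IsChain m → u ∈ m → a ∈ m → u ⋖ a → e ∈ m → e ≤ u ⊎ a ≤ e
  chain-⋖-split chain u∈ a∈ u⋖a e∈ with chain e∈ u∈ | chain e∈ a∈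
  ... | inj₁ e≤u | _        = inj₁ e≤u
  ... | inj₂ _   | inj₂ a≤e = inj₂ a≤e
  ... | inj₂ u≤e | inj₁ e≤a with ⋖-between u⋖a u≤e e≤a
  ...   | inj₁ refl = inj₁ ≤-refl
  ...   | inj₂ refl = inj₂ ≤-refl

  chain-⋖-unique : ∀ {m u a a′} → IsChain m → a ∈ m → a′ ∈ m → u ⋖ a → u ⋖ a′ → a ≡ a′
  chain-⋖-unique chain a∈ a′∈ u⋖a u⋖a′ with chain a∈ a′∈
  ... | inj₁ a≤a′ = ⋖-unique-below u⋖a′ u⋖a a≤a′
  ... | inj₂ a′≤a = sym (⋖-unique-below u⋖a u⋖a′ a′≤a)

  maxChain-restrict : ∀ {a b m x y s} → IsMaxChainIn a b m → x ∈ m → y ∈ m →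
                      (∀ {w} → w ∈ s → w ∈ m × x ≤ w × w ≤ y) →
                      (∀ {w} → w ∈ m → x ≤ w → w ≤ y → w ∈ s) → IsMaxChainIn x y s
  maxChain-restrict {a} {b} {m} {x} {y} {s} (chain , within , maximal) x∈ y∈ s⁻ s⁺ =
    (λ v∈ w∈ → chain (proj₁ (s⁻ v∈)) (proj₁ (s⁻ w∈))) , proj₂ ∘ s⁻ , maximal′
    where
    maximal′ : ∀ t → IsChain t → InInterval x y t → s ⊆ t → t ⊆ s
    maximal′ t chain-t within-t s⊆t w∈t =
      s⁺ (t∪m⊆m (∈-∪ˡ w∈t)) (proj₁ (within-t w∈t)) (proj₂ (within-t w∈t))
      where
      t-vs-m : ∀ {e f} → e ∈ t → f ∈ m → e ≤ f ⊎ f ≤ e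
      t-vs-m e∈ f∈ with chain f∈ x∈ | chain f∈ y∈
      ... | inj₁ f≤x | _        = inj₂ (≤-trans f≤x (proj₁ (within-t e∈)))
      ... | inj₂ _   | inj₂ y≤f = inj₁ (≤-trans (proj₂ (within-t e∈)) y≤f)
      ... | inj₂ x≤f | inj₁ f≤y = chain-t e∈ (s⊆t (s⁺ f∈ x≤f f≤y))
      chain-t∪m : IsChain (t ∪ m)
      chain-t∪m e∈ f∈ with ∈-∪⁻ e∈ | ∈-∪⁻ f∈
      ... | inj₁ e∈t | inj₁ f∈t = chain-t e∈t f∈t
      ... | inj₁ e∈t | inj₂ f∈m = t-vs-m e∈t f∈m
      ... | inj₂ e∈m | inj₁ f∈t = [ inj₂ , inj₁ ] (t-vs-m f∈t e∈m)
      ... | inj₂ e∈m | inj₂ f∈m = chain e∈m f∈m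
      within-t∪m : InInterval a b (t ∪ m)
      within-t∪m e∈ with ∈-∪⁻ e∈
      ... | inj₁ e∈t = ≤-trans (proj₁ (within x∈)) (proj₁ (within-t e∈t))
                     , ≤-trans (proj₂ (within-t e∈t)) (proj₂ (within y∈))
      ... | inj₂ e∈m = within e∈m
      t∪m⊆m : t ∪ m ⊆ m
      t∪m⊆m = maximal (t ∪ m) chain-t∪m within-t∪m ∈-∪ʳ

  maxChain-glue : ∀ {a x b s₁ s₂ s} → a ≤ x → x ≤ b → IsMaxChainIn a x s₁ → IsMaxChainIn x b s₂ →
                  (∀ {w} → w ∈ s → w ∈ s₁ ⊎ w ∈ s₂) → s₁ ⊆ s → s₂ ⊆ s → IsMaxChainIn a b s
  maxChain-glue {a} {x} {b} {s₁} {s₂} {s} a≤x x≤b c₁@(chain₁ , within₁ , maximal₁)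
                (chain₂ , within₂ , maximal₂) s⁻ s₁⊆s s₂⊆s = chain , within , maximal
    where
    chain : IsChain s
    chain v∈ w∈ with s⁻ v∈ | s⁻ w∈
    ... | inj₁ v∈₁ | inj₁ w∈₁ = chain₁ v∈₁ w∈₁
    ... | inj₂ v∈₂ | inj₂ w∈₂ = chain₂ v∈₂ w∈₂
    ... | inj₁ v∈₁ | inj₂ w∈₂ = inj₁ (≤-trans (proj₂ (within₁ v∈₁)) (proj₁ (within₂ w∈₂)))
    ... | inj₂ v∈₂ | inj₁ w∈₁ = inj₂ (≤-trans (proj₂ (within₁ w∈₁)) (proj₁ (within₂ v∈₂)))
    within : InInterval a b s
    within w∈ with s⁻ w∈
    ... | inj₁ w∈₁ = proj₁ (within₁ w∈₁) , ≤-trans (proj₂ (within₁ w∈₁)) x≤b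
    ... | inj₂ w∈₂ = ≤-trans a≤x (proj₁ (within₂ w∈₂)) , proj₂ (within₂ w∈₂)
    maximal : ∀ t → IsChain t → InInterval a b t → s ⊆ t → t ⊆ s
    maximal t chain-t within-t s⊆t {w} w∈t with chain-t w∈t (s⊆t (s₁⊆s (top∈ c₁ a≤x)))
    ... | inj₁ w≤x = s₁⊆s (maximal₁ (below t x) chain-below within-below s₁⊆below (∈-below⁺ w∈t w≤x))
      where
      chain-below : IsChain (below t x)
      chain-below u∈ v∈ = chain-t (proj₁ (∈-below⁻ t u∈)) (proj₁ (∈-below⁻ t v∈))
      within-below : InInterval a x (below t x)
      within-below u∈ = proj₁ (within-t (proj₁ (∈-below⁻ t u∈))) , proj₂ (∈-below⁻ t u∈)
      s₁⊆below : s₁ ⊆ below t x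
      s₁⊆below u∈ = ∈-below⁺ (s⊆t (s₁⊆s u∈)) (proj₂ (within₁ u∈))
    ... | inj₂ x≤w = s₂⊆s (maximal₂ (above t x) chain-above within-above s₂⊆above (∈-above⁺ w∈t x≤w))
      where
      chain-above : IsChain (above t x)
      chain-above u∈ v∈ = chain-t (proj₁ (∈-above⁻ t u∈)) (proj₁ (∈-above⁻ t v∈))
      within-above : InInterval x b (above t x)
      within-above u∈ = proj₂ (∈-above⁻ t u∈) , proj₂ (within-t (proj₁ (∈-above⁻ t u∈)))
      s₂⊆above : s₂ ⊆ above t x
      s₂⊆above u∈ = ∈-above⁺ (s⊆t (s₂⊆s u∈)) (proj₁ (within₂ u∈))

  successor : ∀ {p q m u v} → IsMaxChainIn p q m → u ∈ m → v ∈ m → u <ₚ v →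
              Σ (Fin n) λ a → a ∈ m × u ⋖ a × a ≤ v
  successor {p} {q} {m} {u} {v} c@(chain , within , _) u∈ v∈ u<v
    with least (λ w → (w ∈? m) ×-dec (u <? w)) (λ e f → chain (proj₁ e) (proj₁ f)) v (v∈ , u<v)
  ... | e , (e∈ , u<e) , e-least = e , e∈ , (u<e , nothing-between) , e-least v (v∈ , u<v)
    where
    nothing-between : ∀ t → u <ₚ t → t <ₚ e → ⊥
    nothing-between t u<t t<e = <⇒≱ t<e (e-least t (t∈ , u<t))
      where
      comparable : ∀ {f} → f ∈ m → f ≤ t ⊎ t ≤ f
      comparable f∈ with chain f∈ u∈
      ... | inj₁ f≤u = inj₁ (≤-trans f≤u (<⇒≤ u<t))
      ... | inj₂ u≤f with ≤⇒≡⊎< u≤f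
      ...   | inj₁ refl = inj₁ (<⇒≤ u<t)
      ...   | inj₂ u<f  = inj₂ (≤-trans (<⇒≤ t<e) (e-least _ (f∈ , u<f)))
      t∈ : t ∈ m
      t∈ = insert-comparable c (≤-trans (proj₁ (within u∈)) (<⇒≤ u<t))
                               (≤-trans (<⇒≤ t<e) (proj₂ (within e∈))) comparable

  singleton-maxChain : ∀ {x} → IsMaxChainIn x x ⁅ x ⁆
  singleton-maxChain {x} = chain , within , maximal
    where
    chain : IsChain ⁅ x ⁆
    chain v∈ w∈ with x∈⁅y⁆⇒x≡y x v∈ | x∈⁅y⁆⇒x≡y x w∈
    ... | refl | refl = inj₁ ≤-refl
    within : InInterval x x ⁅ x ⁆
    within w∈ with x∈⁅y⁆⇒x≡y x w∈
    ... | refl = ≤-refl , ≤-refl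
    maximal : ∀ t → IsChain t → InInterval x x t → ⁅ x ⁆ ⊆ t → t ⊆ ⁅ x ⁆
    maximal t _ within-t _ w∈ with antisym (proj₁ (within-t w∈)) (proj₂ (within-t w∈))
    ... | refl = x∈⁅x⁆ x

  cover-maxChain : ∀ {x a} → x ⋖ a → IsMaxChainIn x a (⁅ x ⁆ ∪ ⁅ a ⁆)
  cover-maxChain {x} {a} x⋖a = chain , within , maximal
    where
    endpoint : ∀ {w} → w ∈ ⁅ x ⁆ ∪ ⁅ a ⁆ → w ≡ x ⊎ w ≡ a
    endpoint = Sum.map (x∈⁅y⁆⇒x≡y x) (x∈⁅y⁆⇒x≡y a) ∘ ∈-∪⁻
    chain : IsChain (⁅ x ⁆ ∪ ⁅ a ⁆)
    chain v∈ w∈ with endpoint v∈ | endpoint w∈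
    ... | inj₁ refl | inj₁ refl = inj₁ ≤-refl
    ... | inj₁ refl | inj₂ refl = inj₁ (⋖⇒≤ x⋖a)
    ... | inj₂ refl | inj₁ refl = inj₂ (⋖⇒≤ x⋖a)
    ... | inj₂ refl | inj₂ refl = inj₁ ≤-refl
    within : InInterval x a (⁅ x ⁆ ∪ ⁅ a ⁆)
    within w∈ with endpoint w∈
    ... | inj₁ refl = ≤-refl , ⋖⇒≤ x⋖a
    ... | inj₂ refl = ⋖⇒≤ x⋖a , ≤-refl
    maximal : ∀ t → IsChain t → InInterval x a t → ⁅ x ⁆ ∪ ⁅ a ⁆ ⊆ t → t ⊆ ⁅ x ⁆ ∪ ⁅ a ⁆
    maximal t _ within-t _ w∈ with ⋖-between x⋖a (proj₁ (within-t w∈)) (proj₂ (within-t w∈))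
    ... | inj₁ refl = ∈-∪ˡ (x∈⁅x⁆ x)
    ... | inj₂ refl = ∈-∪ʳ (x∈⁅x⁆ a)

  root-extend : ∀ {x r a} → IsRoot x r → x ⋖ a → IsRoot a (r ∪ ⁅ a ⁆)
  root-extend {x} {r} {a} root x⋖a =
    maxChain-glue (0̂-min x) (⋖⇒≤ x⋖a) root (cover-maxChain x⋖a) split ∈-∪ˡ pair⊆
    where
    split : ∀ {w} → w ∈ r ∪ ⁅ a ⁆ → w ∈ r ⊎ w ∈ ⁅ x ⁆ ∪ ⁅ a ⁆
    split = Sum.map₂ ∈-∪ʳ ∘ ∈-∪⁻
    pair⊆ : ⁅ x ⁆ ∪ ⁅ a ⁆ ⊆ r ∪ ⁅ a ⁆
    pair⊆ w∈ with ∈-∪⁻ w∈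
    ... | inj₂ w∈a = ∈-∪ʳ w∈a
    ... | inj₁ w∈x with x∈⁅y⁆⇒x≡y x w∈x
    ...   | refl = ∈-∪ˡ (top∈ root (0̂-min x))

  below-root : ∀ {m u} → IsMaxChain m → u ∈ m → IsRoot u (below m u)
  below-root {m} c u∈ = maxChain-restrict c (0̂∈ c) u∈
    (λ w∈ → let (w∈m , w≤u) = ∈-below⁻ m w∈ in w∈m , 0̂-min _ , w≤u) (λ w∈ _ → ∈-below⁺ w∈)

  above-maxChain : ∀ {m v} → IsMaxChain m → v ∈ m → IsMaxChainIn v 1̂ (above m v)
  above-maxChain {m} c v∈ = maxChain-restrict c v∈ (1̂∈ c)
    (λ w∈ → let (w∈m , v≤w) = ∈-above⁻ m w∈ in w∈m , v≤w , 1̂-max _) (λ w∈ v≤w _ → ∈-above⁺ w∈ v≤w)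

  between-maxChain : ∀ {a b m x y} → IsMaxChainIn a b m → x ∈ m → y ∈ m → IsMaxChainIn x y (between m x y)
  between-maxChain {m = m} c x∈ y∈ = maxChain-restrict c x∈ y∈ (∈-between⁻ m) ∈-between⁺

  below-0̂ : ∀ {m} → IsMaxChain m → below m 0̂ ≡ ⁅ 0̂ ⁆
  below-0̂ {m} c = ⊆-antisym
    (λ w∈ → subst (_∈ ⁅ 0̂ ⁆) (antisym (0̂-min _) (proj₂ (∈-below⁻ m w∈))) (x∈⁅x⁆ 0̂))
    (λ w∈ → subst (_∈ below m 0̂) (sym (x∈⁅y⁆⇒x≡y 0̂ w∈)) (∈-below⁺ (0̂∈ c) ≤-refl))

  below-1̂ : ∀ {m} → below m 1̂ ≡ m
  below-1̂ {m} = ⊆-antisym (proj₁ ∘ ∈-below⁻ m) (λ w∈ → ∈-below⁺ w∈ (1̂-max _))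

  below-⋖ : ∀ {m x a} → IsChain m → x ∈ m → a ∈ m → x ⋖ a → below m a ≡ below m x ∪ ⁅ a ⁆
  below-⋖ {m} {x} {a} chain x∈ a∈ x⋖a = ⊆-antisym ⊆ʳ ⊆ˡ
    where
    ⊆ʳ : below m a ⊆ below m x ∪ ⁅ a ⁆
    ⊆ʳ w∈ with ∈-below⁻ m w∈
    ... | w∈m , w≤a with chain-⋖-split chain x∈ a∈ x⋖a w∈m
    ...   | inj₁ w≤x = ∈-∪ˡ (∈-below⁺ w∈m w≤x)
    ...   | inj₂ a≤w with antisym w≤a a≤w
    ...     | refl = ∈-∪ʳ (x∈⁅x⁆ a)
    ⊆ˡ : below m x ∪ ⁅ a ⁆ ⊆ below m a
    ⊆ˡ w∈ with ∈-insert⁻ w∈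
    ... | inj₁ w∈ₓ = let (w∈m , w≤x) = ∈-below⁻ m w∈ₓ in ∈-below⁺ w∈m (≤-trans w≤x (⋖⇒≤ x⋖a))
    ... | inj₂ refl = ∈-below⁺ a∈ ≤-refl

  root-absorbs : ∀ {x y r s} → x ∈ r → InInterval x y s → r ∪ below s x ≡ r
  root-absorbs {x} {y} {r} {s} x∈ within = ⊆-antisym absorb ∈-∪ˡ
    where
    absorb : r ∪ below s x ⊆ r
    absorb w∈ with ∈-∪⁻ w∈
    ... | inj₁ w∈r = w∈r
    ... | inj₂ w∈ₛ with ∈-below⁻ s w∈ₛ
    ...   | w∈s , w≤x with antisym w≤x (proj₁ (within w∈s))
    ...     | refl = x∈

  maxChain-cons : ∀ {x a y c} → x ⋖ a → a ≤ y → IsMaxChainIn a y c → IsMaxChainIn x y (⁅ x ⁆ ∪ c)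
  maxChain-cons {x} {a} {y} {c} x⋖a a≤y c-max =
    maxChain-glue (⋖⇒≤ x⋖a) a≤y (cover-maxChain x⋖a) c-max split pair⊆ ∈-∪ʳ
    where
    split : ∀ {w} → w ∈ ⁅ x ⁆ ∪ c → w ∈ ⁅ x ⁆ ∪ ⁅ a ⁆ ⊎ w ∈ c
    split = Sum.map₁ ∈-∪ˡ ∘ ∈-∪⁻
    pair⊆ : ⁅ x ⁆ ∪ ⁅ a ⁆ ⊆ ⁅ x ⁆ ∪ c
    pair⊆ w∈ with ∈-insert⁻ w∈
    ... | inj₁ w∈x = ∈-∪ˡ w∈x
    ... | inj₂ refl = ∈-∪ʳ (bottom∈ c-max a≤y)

  root-cons : ∀ {r x a c z} → x ∈ r → a ∈ c → a ≤ z → (r ∪ ⁅ a ⁆) ∪ below c z ≡ r ∪ below (⁅ x ⁆ ∪ c) z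
  root-cons {r} {x} {a} {c} {z} x∈r a∈c a≤z = ⊆-antisym ⊆ʳ ⊆ˡ
    where
    ⊆ʳ : (r ∪ ⁅ a ⁆) ∪ below c z ⊆ r ∪ below (⁅ x ⁆ ∪ c) z
    ⊆ʳ e∈ with ∈-∪⁻ e∈
    ... | inj₂ e∈c↓ = let (e∈c , e≤z) = ∈-below⁻ c e∈c↓ in ∈-∪ʳ (∈-below⁺ (∈-∪ʳ {p = ⁅ x ⁆} e∈c) e≤z)
    ... | inj₁ e∈ra with ∈-insert⁻ e∈ra
    ...   | inj₁ e∈r = ∈-∪ˡ e∈r
    ...   | inj₂ refl = ∈-∪ʳ (∈-below⁺ (∈-∪ʳ {p = ⁅ x ⁆} a∈c) a≤z)
    ⊆ˡ : r ∪ below (⁅ x ⁆ ∪ c) z ⊆ (r ∪ ⁅ a ⁆) ∪ below c z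
    ⊆ˡ e∈ with ∈-∪⁻ e∈
    ... | inj₁ e∈r = ∈-∪ˡ (∈-∪ˡ e∈r)
    ... | inj₂ e∈xc↓ with ∈-below⁻ (⁅ x ⁆ ∪ c) e∈xc↓
    ...   | e∈xc , e≤z with ∈-∪⁻ e∈xc
    ...     | inj₂ e∈c = ∈-∪ʳ (∈-below⁺ e∈c e≤z)
    ...     | inj₁ e∈x with x∈⁅y⁆⇒x≡y x e∈x
    ...       | refl = ∈-∪ˡ (∈-∪ˡ x∈r)

module Splice {n : ℕ} (P : FinBoundedPoset n) where
  open Chains P public

  splice : Subset n → Fin n → Subset n → Fin n → Subset n
  splice m u c v = below m u ∪ (c ∪ above m v)

  ∈-splice⁻ : ∀ m {u c v w} → w ∈ splice m u c v → (w ∈ m × w ≤ u) ⊎ w ∈ c ⊎ (w ∈ m × v ≤ w)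
  ∈-splice⁻ m w∈ with ∈-∪⁻ w∈
  ... | inj₁ w∈b = inj₁ (∈-below⁻ m w∈b)
  ... | inj₂ w∈r with ∈-∪⁻ w∈r
  ...   | inj₁ w∈c = inj₂ (inj₁ w∈c)
  ...   | inj₂ w∈a = inj₂ (inj₂ (∈-above⁻ m w∈a))

  ∈-splice-below : ∀ {m u c v w} → w ∈ m → w ≤ u → w ∈ splice m u c v
  ∈-splice-below w∈ w≤u = ∈-∪ˡ (∈-below⁺ w∈ w≤u)

  ∈-splice-inner : ∀ {m u c v w} → w ∈ c → w ∈ splice m u c v
  ∈-splice-inner = ∈-∪ʳ ∘ ∈-∪ˡ

  ∈-splice-above : ∀ {m u c v w} → w ∈ m → v ≤ w → w ∈ splice m u c v
  ∈-splice-above w∈ v≤w = ∈-∪ʳ (∈-∪ʳ (∈-above⁺ w∈ v≤w))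

  splice-maxChain : ∀ {m u c v} → IsMaxChain m → u ∈ m → v ∈ m → u ≤ v → IsMaxChainIn u v c →
                    IsMaxChain (splice m u c v)
  splice-maxChain {m} {u} {c} {v} chain-m u∈ v∈ u≤v chain-c =
    maxChain-glue (0̂-min u) (1̂-max u) (below-root chain-m u∈) upper ∈-∪⁻ ∈-∪ˡ ∈-∪ʳ
    where
    upper : IsMaxChainIn u 1̂ (c ∪ above m v)
    upper = maxChain-glue u≤v (1̂-max v) chain-c (above-maxChain chain-m v∈) ∈-∪⁻ ∈-∪ˡ ∈-∪ʳ

  splice-below : ∀ {m u c v w} → InInterval u v c → u ∈ m → w ≤ u → below (splice m u c v) w ≡ below m w
  splice-below {m} {u} {c} {v} {w} within u∈ w≤u = ⊆-antisym ⊆ʳ ⊆ˡ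
    where
    ⊆ʳ : below (splice m u c v) w ⊆ below m w
    ⊆ʳ e∈ with ∈-below⁻ (splice m u c v) e∈
    ... | e∈s , e≤w with ∈-splice⁻ m e∈s
    ...   | inj₁ (e∈m , _)        = ∈-below⁺ e∈m e≤w
    ...   | inj₂ (inj₂ (e∈m , _)) = ∈-below⁺ e∈m e≤w
    ...   | inj₂ (inj₁ e∈c) with antisym (≤-trans e≤w w≤u) (proj₁ (within e∈c))
    ...     | refl = ∈-below⁺ u∈ e≤w
    ⊆ˡ : below m w ⊆ below (splice m u c v) w
    ⊆ˡ e∈ with ∈-below⁻ m e∈
    ... | e∈m , e≤w = ∈-below⁺ (∈-splice-below e∈m (≤-trans e≤w w≤u)) e≤w

  splice-above : ∀ {m u c v w} → InInterval u v c → v ∈ m → v ≤ w → above (splice m u c v) w ≡ above m w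
  splice-above {m} {u} {c} {v} {w} within v∈ v≤w = ⊆-antisym ⊆ʳ ⊆ˡ
    where
    ⊆ʳ : above (splice m u c v) w ⊆ above m w
    ⊆ʳ e∈ with ∈-above⁻ (splice m u c v) e∈
    ... | e∈s , w≤e with ∈-splice⁻ m e∈s
    ...   | inj₁ (e∈m , _)        = ∈-above⁺ e∈m w≤e
    ...   | inj₂ (inj₂ (e∈m , _)) = ∈-above⁺ e∈m w≤e
    ...   | inj₂ (inj₁ e∈c) with antisym (proj₂ (within e∈c)) (≤-trans v≤w w≤e)
    ...     | refl = ∈-above⁺ v∈ w≤e
    ⊆ˡ : above m w ⊆ above (splice m u c v) w
    ⊆ˡ e∈ with ∈-above⁻ m e∈
    ... | e∈m , w≤e = ∈-above⁺ (∈-splice-above e∈m (≤-trans v≤w w≤e)) w≤e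

  splice-between : ∀ {m u c v} → InInterval u v c → u ∈ c → v ∈ c → between (splice m u c v) u v ≡ c
  splice-between {m} {u} {c} {v} within u∈ v∈ = ⊆-antisym ⊆ʳ ⊆ˡ
    where
    ⊆ʳ : between (splice m u c v) u v ⊆ c
    ⊆ʳ e∈ with ∈-between⁻ (splice m u c v) e∈
    ... | e∈s , u≤e , e≤v with ∈-splice⁻ m e∈s
    ...   | inj₂ (inj₁ e∈c) = e∈c
    ...   | inj₁ (_ , e≤u) with antisym e≤u u≤e
    ...     | refl = u∈
    ⊆ʳ e∈ | e∈s , u≤e , e≤v | inj₂ (inj₂ (_ , v≤e)) with antisym e≤v v≤e
    ...     | refl = v∈
    ⊆ˡ : c ⊆ between (splice m u c v) u v
    ⊆ˡ e∈ = ∈-between⁺ (∈-splice-inner {m} e∈) (proj₁ (within e∈)) (proj₂ (within e∈))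

  splice-⋖ : ∀ {m c u v} → IsChain m → u ∈ m → v ∈ m → u ⋖ v → InInterval u v c → splice m u c v ≡ m
  splice-⋖ {m} {c} {u} {v} chain u∈ v∈ u⋖v within = ⊆-antisym ⊆ʳ ⊆ˡ
    where
    ⊆ʳ : splice m u c v ⊆ m
    ⊆ʳ e∈ with ∈-splice⁻ m e∈
    ... | inj₁ (e∈m , _)        = e∈m
    ... | inj₂ (inj₂ (e∈m , _)) = e∈m
    ... | inj₂ (inj₁ e∈c) with ⋖-between u⋖v (proj₁ (within e∈c)) (proj₂ (within e∈c))
    ...   | inj₁ refl = u∈
    ...   | inj₂ refl = v∈
    ⊆ˡ : m ⊆ splice m u c v
    ⊆ˡ e∈ = [ ∈-splice-below e∈ , ∈-splice-above e∈ ] (chain-⋖-split chain u∈ v∈ u⋖v e∈)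

  splice-shift : ∀ {m c u a v} → IsChain m → IsChain c → u ∈ m → a ∈ m → u ⋖ a → a ∈ c →
                 InInterval u v c → splice m a (between c a v) v ≡ splice m u c v
  splice-shift {m} {c} {u} {a} {v} chain-m chain-c u∈ a∈ u⋖a a∈c within = ⊆-antisym ⊆ʳ ⊆ˡ
    where
    ⊆ʳ : splice m a (between c a v) v ⊆ splice m u c v
    ⊆ʳ e∈ with ∈-splice⁻ m e∈
    ... | inj₂ (inj₂ (e∈m , v≤e)) = ∈-splice-above e∈m v≤e
    ... | inj₂ (inj₁ e∈b) = ∈-splice-inner {m} (proj₁ (∈-between⁻ c e∈b))
    ... | inj₁ (e∈m , e≤a) with chain-⋖-split chain-m u∈ a∈ u⋖a e∈m
    ...   | inj₁ e≤u = ∈-splice-below e∈m e≤u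
    ...   | inj₂ a≤e with antisym e≤a a≤e
    ...     | refl = ∈-splice-inner {m} a∈c
    ⊆ˡ : splice m u c v ⊆ splice m a (between c a v) v
    ⊆ˡ e∈ with ∈-splice⁻ m e∈
    ... | inj₁ (e∈m , e≤u) = ∈-splice-below e∈m (≤-trans e≤u (⋖⇒≤ u⋖a))
    ... | inj₂ (inj₂ (e∈m , v≤e)) = ∈-splice-above e∈m v≤e
    ... | inj₂ (inj₁ e∈c) with chain-c e∈c a∈c
    ...   | inj₂ a≤e = ∈-splice-inner {m} (∈-between⁺ e∈c a≤e (proj₂ (within e∈c)))
    ...   | inj₁ e≤a with ⋖-between u⋖a (proj₁ (within e∈c)) e≤a
    ...     | inj₁ refl = ∈-splice-below u∈ (⋖⇒≤ u⋖a)
    ...     | inj₂ refl = ∈-splice-below a∈ ≤-refl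

  root-shift : ∀ {m c d u a z} → IsChain m → IsChain c → u ∈ m → a ∈ m → u ⋖ a → a ∈ c →
               (∀ {w} → w ∈ c → u ≤ w) →
               (∀ {w} → w ∈ d → w ∈ c × a ≤ w) → (∀ {w} → w ∈ c → a ≤ w → w ∈ d) → a ≤ z →
               below m a ∪ below d z ≡ below m u ∪ below c z
  root-shift {m} {c} {d} {u} {a} {z} chain-m chain-c u∈ a∈ u⋖a a∈c u≤c d⁻ d⁺ a≤z = ⊆-antisym ⊆ʳ ⊆ˡ
    where
    ⊆ʳ : below m a ∪ below d z ⊆ below m u ∪ below c z
    ⊆ʳ e∈ with ∈-∪⁻ e∈
    ... | inj₂ e∈d↓ = let (e∈d , e≤z) = ∈-below⁻ d e∈d↓ in ∈-∪ʳ (∈-below⁺ (proj₁ (d⁻ e∈d)) e≤z)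
    ... | inj₁ e∈m↓ with ∈-below⁻ m e∈m↓
    ...   | e∈m , e≤a with chain-⋖-split chain-m u∈ a∈ u⋖a e∈m
    ...     | inj₁ e≤u = ∈-∪ˡ (∈-below⁺ e∈m e≤u)
    ...     | inj₂ a≤e with antisym e≤a a≤e
    ...       | refl = ∈-∪ʳ (∈-below⁺ a∈c a≤z)
    ⊆ˡ : below m u ∪ below c z ⊆ below m a ∪ below d z
    ⊆ˡ e∈ with ∈-∪⁻ e∈
    ... | inj₁ e∈m↓ = let (e∈m , e≤u) = ∈-below⁻ m e∈m↓ in ∈-∪ˡ (∈-below⁺ e∈m (≤-trans e≤u (⋖⇒≤ u⋖a)))
    ... | inj₂ e∈c↓ with ∈-below⁻ c e∈c↓
    ...   | e∈c , e≤z with chain-c e∈c a∈c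
    ...     | inj₂ a≤e = ∈-∪ʳ (∈-below⁺ (d⁺ e∈c a≤e) e≤z)
    ...     | inj₁ e≤a with ⋖-between u⋖a (u≤c e∈c) e≤a
    ...       | inj₁ refl = ∈-∪ˡ (∈-below⁺ u∈ (⋖⇒≤ u⋖a))
    ...       | inj₂ refl = ∈-∪ˡ (∈-below⁺ a∈ ≤-refl)

module FirstAtomChains {n : ℕ} (P : FinBoundedPoset n) (Ω : Subset n → Fin n → Fin n → Fin n)
                       (rfas : RFASCondition P Ω) where
  open Splice P public

  IsFirstAtomChain : Subset n → Fin n → Fin n → Subset n → Set
  IsFirstAtomChain = Defs.IsFirstAtomChain P Ω

  IsPseudoDescent : Subset n → Fin n → Fin n → Fin n → Set
  IsPseudoDescent = Defs.IsPseudoDescent P Ω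

  Ω-atom : ∀ {x y r} → x <ₚ y → IsRoot x r → x ⋖ Ω r x y × Ω r x y ≤ y
  Ω-atom x<y root = proj₁ (rfas _ _ _ x<y root)

  firstAtomChain-head : ∀ {r u v c} → IsRoot u r → u <ₚ v → IsFirstAtomChain r u v c →
                        Ω r u v ∈ c × u ⋖ Ω r u v
  firstAtomChain-head {r} {u} {v} {c} root u<v (c-max , first-atoms)
    with successor c-max (bottom∈ c-max (<⇒≤ u<v)) (top∈ c-max (<⇒≤ u<v)) u<v
  ... | a , a∈ , u⋖a , a≤v with ≤⇒≡⊎< a≤v
  ...   | inj₁ refl = subst (_∈ c) (sym Ω≡a) a∈ , subst (u ⋖_) (sym Ω≡a) u⋖a
    where
    Ω≡a : Ω r u v ≡ a
    Ω≡a = ⋖-unique-below u⋖a (proj₁ (Ω-atom u<v root)) (proj₂ (Ω-atom u<v root))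
  ...   | inj₂ a<v = subst (_∈ c) a≡Ω a∈ , subst (u ⋖_) a≡Ω u⋖a
    where
    a≡Ω : a ≡ Ω r u v
    a≡Ω = trans (first-atoms (bottom∈ c-max (<⇒≤ u<v)) a∈ u⋖a a<v)
                (cong (λ s → Ω s u v) (root-absorbs (top∈ root (0̂-min u)) (proj₁ (proj₂ c-max))))

  firstAtomChain-without-interior : ∀ {r x z c} → IsMaxChainIn x z c →
                                    (∀ {w} → w ∈ c → w <ₚ z → w ≡ x) → IsFirstAtomChain r x z c
  firstAtomChain-without-interior c-max@(_ , within , _) interior =
    c-max , λ p∈ w∈ p⋖w w<z → ⊥-elim (<⇒≱ (⋖⇒< p⋖w) (subst (_≤ _) (sym (interior w∈ w<z)) (proj₁ (within p∈))))

  firstAtomChain-cons : ∀ {r x y c} → IsRoot x r → x <ₚ y →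
                        IsFirstAtomChain (r ∪ ⁅ Ω r x y ⁆) (Ω r x y) y c →
                        IsFirstAtomChain r x y (⁅ x ⁆ ∪ c)
  firstAtomChain-cons {r} {x} {y} {c} root x<y (c-max , first-atoms) = x∷c-max , first-atoms′
    where
    a = Ω r x y
    x⋖a = proj₁ (Ω-atom x<y root)
    a≤y = proj₂ (Ω-atom x<y root)
    within-c = proj₁ (proj₂ c-max)
    a∈c : a ∈ c
    a∈c = bottom∈ c-max a≤y
    x∷c-max : IsMaxChainIn x y (⁅ x ⁆ ∪ c)
    x∷c-max = maxChain-cons x⋖a a≤y c-max
    x∈r : x ∈ r
    x∈r = top∈ root (0̂-min x)
    first-atoms′ : ∀ {z w} → z ∈ ⁅ x ⁆ ∪ c → w ∈ ⁅ x ⁆ ∪ c → z ⋖ w → w <ₚ y →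
                   w ≡ Ω (r ∪ below (⁅ x ⁆ ∪ c) z) z y
    first-atoms′ z∈ w∈ z⋖w w<y with ∈-∪⁻ w∈
    ... | inj₁ w∈x = ⊥-elim (<⇒≱ (⋖⇒< z⋖w)
                       (subst (_≤ _) (sym (x∈⁅y⁆⇒x≡y x w∈x)) (proj₁ (proj₁ (proj₂ x∷c-max) z∈))))
    ... | inj₂ w∈c with ∈-∪⁻ z∈
    ...   | inj₂ z∈c =
      trans (first-atoms z∈c w∈c z⋖w w<y) (cong (λ s → Ω s _ y) (root-cons x∈r a∈c (proj₁ (within-c z∈c))))
    ...   | inj₁ z∈x with x∈⁅y⁆⇒x≡y x z∈x
    ...     | refl = trans (sym (⋖-unique-below z⋖w x⋖a (proj₁ (within-c w∈c))))
                           (cong (λ s → Ω s x y) (sym (root-absorbs x∈r (proj₁ (proj₂ x∷c-max)))))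

  firstAtomChain-exists : ∀ x y r → x ≤ y → IsRoot x r → ∃[ c ] IsFirstAtomChain r x y c
  firstAtomChain-exists = upward-induction _ step
    where
    step : ∀ x → (∀ {x′} → x <ₚ x′ → ∀ y r → x′ ≤ y → IsRoot x′ r → ∃[ c ] IsFirstAtomChain r x′ y c) →
           ∀ y r → x ≤ y → IsRoot x r → ∃[ c ] IsFirstAtomChain r x y c
    step x IH y r x≤y root with ≤⇒≡⊎< x≤y
    ... | inj₁ refl = ⁅ x ⁆ , firstAtomChain-without-interior singleton-maxChain (λ w∈ _ → x∈⁅y⁆⇒x≡y x w∈)
    ... | inj₂ x<y with Ω-atom x<y root
    ...   | x⋖a , a≤y with IH (⋖⇒< x⋖a) y (r ∪ ⁅ Ω r x y ⁆) a≤y (root-extend root x⋖a)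
    ...     | c , c-first = ⁅ x ⁆ ∪ c , firstAtomChain-cons root x<y c-first

  PseudoDescentIn : Subset n → Fin n → Fin n → Set
  PseudoDescentIn m x z = ∃[ p ] ∃[ w ] ∃[ w⁺ ] IsPseudoDescent m p w w⁺ × x ≤ p × w⁺ ≤ z

  between-firstAtomChain-cons : ∀ {m x a b z} → IsMaxChain m → x ∈ m → a ∈ m → b ∈ m → x ⋖ a → a ⋖ b →
                                b ≤ z → a ≡ Ω (below m x) x b →
                                IsFirstAtomChain (below m a) a z (between m a z) →
                                IsFirstAtomChain (below m x) x z (between m x z)
  between-firstAtomChain-cons {m} {x} {a} {b} {z} m-max x∈ a∈ b∈ x⋖a a⋖b b≤z a≡Ωb a-first =
    between-maxChain m-max x∈ z∈ , first-atoms
    where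
    r = below m x
    chain-m = proj₁ m-max
    a<z = <-≤-trans (⋖⇒< a⋖b) b≤z
    x<z = <-trans (⋖⇒< x⋖a) a<z
    z∈ = proj₁ (∈-between⁻ m (top∈ (proj₁ a-first) (<⇒≤ a<z)))
    root-x : IsRoot x r
    root-x = below-root m-max x∈
    b≡Ω : b ≡ Ω (r ∪ ⁅ a ⁆) a z
    b≡Ω with firstAtomChain-head (below-root m-max a∈) a<z a-first
    ... | Ω∈ , a⋖Ω = subst (λ s → b ≡ Ω s a z) (below-⋖ chain-m x∈ a∈ x⋖a)
                       (chain-⋖-unique chain-m b∈ (proj₁ (∈-between⁻ m Ω∈)) a⋖b a⋖Ω)
    a≡Ω : a ≡ Ω r x z
    a≡Ω = Equivalence.from (proj₁ (proj₂ (rfas x z r x<z root-x) a (x⋖a , <⇒≤ a<z) a<z))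
                           (subst (λ t → a ≡ Ω r x t) b≡Ω a≡Ωb)
    first-atoms : ∀ {p w} → p ∈ between m x z → w ∈ between m x z → p ⋖ w → w <ₚ z →
                  w ≡ Ω (r ∪ below (between m x z) p) p z
    first-atoms {p} {w} p∈ w∈ p⋖w w<z with ∈-between⁻ m p∈ | ∈-between⁻ m w∈
    ... | p∈m , x≤p , p≤z | w∈m , _ , w≤z with chain-⋖-split chain-m x∈ a∈ x⋖a p∈m
    ...   | inj₁ p≤x with antisym p≤x x≤p
    ...     | refl = trans (chain-⋖-unique chain-m w∈m a∈ p⋖w x⋖a)
                           (trans a≡Ω (cong (λ s → Ω s x z) (sym (root-absorbs (top∈ root-x (0̂-min x))
                                                                     (proj₂ ∘ ∈-between⁻ m)))))
    first-atoms {p} {w} p∈ w∈ p⋖w w<z | p∈m , _ , p≤z | w∈m , _ , w≤z | inj₂ a≤p =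
      trans (proj₂ a-first (∈-between⁺ p∈m a≤p p≤z) (∈-between⁺ w∈m (≤-trans a≤p (⋖⇒≤ p⋖w)) w≤z) p⋖w w<z)
            (cong (λ s → Ω s p z) roots-agree)
      where
      roots-agree : below m a ∪ below (between m a z) p ≡ r ∪ below (between m x z) p
      roots-agree = root-shift chain-m (λ u∈ v∈ → chain-m (proj₁ (∈-between⁻ m u∈)) (proj₁ (∈-between⁻ m v∈)))
        x∈ a∈ x⋖a (∈-between⁺ a∈ (⋖⇒≤ x⋖a) (<⇒≤ a<z)) (proj₁ ∘ proj₂ ∘ ∈-between⁻ m)
        (λ u∈ → let (u∈m , a≤u , u≤z) = ∈-between⁻ m u∈ in ∈-between⁺ u∈m (≤-trans (⋖⇒≤ x⋖a) a≤u) u≤z , a≤u)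
        (λ u∈ a≤u → let (u∈m , _ , u≤z) = ∈-between⁻ m u∈ in ∈-between⁺ u∈m a≤u u≤z)
        a≤p

  pseudoDescent-or-firstAtomChain : ∀ {m} → IsMaxChain m → ∀ x → x ∈ m → ∀ {z} → z ∈ m → x ≤ z →
                                    PseudoDescentIn m x z ⊎ IsFirstAtomChain (below m x) x z (between m x z)
  pseudoDescent-or-firstAtomChain {m} m-max = upward-induction _ step
    where
    Goal : Fin n → Set
    Goal x = x ∈ m → ∀ {z} → z ∈ m → x ≤ z →
             PseudoDescentIn m x z ⊎ IsFirstAtomChain (below m x) x z (between m x z)
    step : ∀ x → (∀ {x′} → x <ₚ x′ → Goal x′) → Goal x
    step x IH x∈ {z} z∈ x≤z with ≤⇒≡⊎< x≤z
    ... | inj₁ refl = inj₂ (firstAtomChain-without-interior (between-maxChain m-max x∈ z∈)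
                              (λ w∈ _ → let (_ , x≤w , w≤x) = ∈-between⁻ m w∈ in antisym w≤x x≤w))
    ... | inj₂ x<z with successor m-max x∈ z∈ x<z
    ...   | a , a∈ , x⋖a , a≤z with IH (⋖⇒< x⋖a) a∈ z∈ a≤z
    ...     | inj₁ (p , w , w⁺ , descent , a≤p , w⁺≤z) =
                inj₁ (p , w , w⁺ , descent , ≤-trans (⋖⇒≤ x⋖a) a≤p , w⁺≤z)
    ...     | inj₂ a-first with ≤⇒≡⊎< a≤z
    ...       | inj₁ refl = inj₂ (firstAtomChain-without-interior (between-maxChain m-max x∈ z∈) interior)
      where
      interior : ∀ {w} → w ∈ between m x a → w <ₚ a → w ≡ x
      interior w∈ w<a with ∈-between⁻ m w∈
      ... | _ , x≤w , w≤a = [ id , (λ w≡a → ⊥-elim (<⇒≢ w<a w≡a)) ] (⋖-between x⋖a x≤w w≤a)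
    ...       | inj₂ a<z with successor m-max a∈ z∈ a<z
    ...         | b , b∈ , a⋖b , b≤z with a ≟ Ω (below m x) x b
    ...           | no a≢Ωb = inj₁ (x , a , b , (x∈ , a∈ , b∈ , x⋖a , a⋖b , a≢Ωb) , ≤-refl , b≤z)
    ...           | yes a≡Ωb = inj₂ (between-firstAtomChain-cons m-max x∈ a∈ b∈ x⋖a a⋖b b≤z a≡Ωb a-first)

  firstAtomChain-tail : ∀ {m u a v c} → IsChain m → u ∈ m → a ∈ m → u ⋖ a → a ≤ v → a ∈ c →
                        IsFirstAtomChain (below m u) u v c → IsFirstAtomChain (below m a) a v (between c a v)
  firstAtomChain-tail {m} {u} {a} {v} {c} chain-m u∈ a∈ u⋖a a≤v a∈c (c-max , first-atoms) =
    between-maxChain c-max a∈c (top∈ c-max (≤-trans (⋖⇒≤ u⋖a) a≤v)) , first-atoms′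
    where
    within = proj₁ (proj₂ c-max)
    first-atoms′ : ∀ {z w} → z ∈ between c a v → w ∈ between c a v → z ⋖ w → w <ₚ v →
                   w ≡ Ω (below m a ∪ below (between c a v) z) z v
    first-atoms′ z∈ w∈ z⋖w w<v with ∈-between⁻ c z∈ | ∈-between⁻ c w∈
    ... | z∈c , a≤z , _ | w∈c , _ =
      trans (first-atoms z∈c w∈c z⋖w w<v) (cong (λ s → Ω s _ v) (sym roots-agree))
      where
      roots-agree : below m a ∪ below (between c a v) _ ≡ below m u ∪ below c _
      roots-agree = root-shift chain-m (proj₁ c-max) u∈ a∈ u⋖a a∈c (proj₁ ∘ within)
        (λ e∈ → let (e∈c , a≤e , _) = ∈-between⁻ c e∈ in e∈c , a≤e)
        (λ e∈ a≤e → ∈-between⁺ e∈ a≤e (proj₂ (within e∈))) a≤z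

module Ordering {n : ℕ} (P : FinBoundedPoset n) (Ω : Subset n → Fin n → Fin n → Fin n)
                (rfas : RFASCondition P Ω) where
  open FirstAtomChains P Ω rfas public

  infix 4 _⟶_ _⪯_

  _⟶_ : Subset n → Subset n → Set
  _⟶_ = Defs._⟶_ P Ω

  _⪯_ : Subset n → Subset n → Set
  _⪯_ = Defs._⪯_ P Ω

  splice-⟶ : ∀ {m x y z c} → IsMaxChain m → IsPseudoDescent m x y z →
             IsFirstAtomChain (below m x) x z c → splice m x c z ⟶ m
  splice-⟶ {m} {x} {y} {z} {c} m-max descent@(x∈ , _ , z∈ , x⋖y , y⋖z , _) c-first@(c-max , _) =
    splice-maxChain m-max x∈ z∈ x≤z c-max , m-max , x , y , z ,
    ∈-splice-below x∈ ≤-refl , ∈-splice-above z∈ ≤-refl ,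
    splice-below within x∈ ≤-refl , splice-above within z∈ ≤-refl , descent ,
    subst₂ (λ r s → IsFirstAtomChain r x z s) (sym (splice-below within x∈ ≤-refl))
           (sym (splice-between {m} within (bottom∈ c-max x≤z) (top∈ c-max x≤z))) c-first
    where
    x≤z = ≤-trans (⋖⇒≤ x⋖y) (⋖⇒≤ y⋖z)
    within = proj₁ (proj₂ c-max)

  SplicesBelow : Fin n → Set
  SplicesBelow u = ∀ {v m c} → u <ₚ v → IsMaxChain m → u ∈ m → v ∈ m →
                   IsFirstAtomChain (below m u) u v c → splice m u c v ⪯ m

  module SpliceStep (u : Fin n) (IH : ∀ {u′} → u <ₚ u′ → SplicesBelow u′)
                    {v m c} (u<v : u <ₚ v) (m-max : IsMaxChain m) (u∈ : u ∈ m) (v∈ : v ∈ m)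
                    (c-first : IsFirstAtomChain (below m u) u v c) where

    r : Subset n
    r = below m u

    root : IsRoot u r
    root = below-root m-max u∈

    u⋖Ω : u ⋖ Ω r u v
    u⋖Ω = proj₁ (Ω-atom u<v root)

    record AgreesOutside (m′ : Subset n) : Set where
      field
        max     : IsMaxChain m′
        u∈m′    : u ∈ m′
        v∈m′    : v ∈ m′
        below-u : below m′ u ≡ r
        above-v : above m′ v ≡ above m v

      splice-agrees : splice m′ u c v ≡ splice m u c v
      splice-agrees = cong₂ (λ s t → s ∪ (c ∪ t)) below-u above-v

    m-agrees : AgreesOutside m
    m-agrees = record { max = m-max ; u∈m′ = u∈ ; v∈m′ = v∈ ; below-u = refl ; above-v = refl }

    Reaches : Fin n → Set
    Reaches a = ∀ {m′} → AgreesOutside m′ → a ∈ m′ → splice m u c v ⪯ m′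

    atom<v : ∀ {a} → u ⋖ a → a ≤ v → a ≢ Ω r u v → a <ₚ v
    atom<v u⋖a a≤v a≢Ω = a≤v , λ a≡v →
      a≢Ω (trans a≡v (sym (⋖-unique-below (subst (u ⋖_) a≡v u⋖a) u⋖Ω (proj₂ (Ω-atom u<v root)))))

    first-atom-case : Reaches (Ω r u v)
    first-atom-case {m′} agrees a∈ = subst (_⪯ m′) splice-agrees splice⪯m′
      where
      open AgreesOutside agrees
      a = Ω r u v
      within = proj₁ (proj₂ (proj₁ c-first))
      a∈c = proj₁ (firstAtomChain-head root u<v c-first)
      splice⪯m′ : splice m′ u c v ⪯ m′
      splice⪯m′ with ≤⇒≡⊎< (proj₂ (Ω-atom u<v root))
      ... | inj₁ a≡v = subst (_⪯ m′) (sym (splice-⋖ (proj₁ max) u∈m′ v∈m′ (subst (u ⋖_) a≡v u⋖Ω) within)) ε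
      ... | inj₂ a<v = subst (_⪯ m′) (splice-shift (proj₁ max) (proj₁ (proj₁ c-first)) u∈m′ a∈ u⋖Ω a∈c within)
                             (IH (⋖⇒< u⋖Ω) a<v max a∈ v∈m′ tail-first)
        where
        tail-first : IsFirstAtomChain (below m′ a) a v (between c a v)
        tail-first = firstAtomChain-tail (proj₁ max) u∈m′ a∈ u⋖Ω (<⇒≤ a<v) a∈c
                       (subst (λ s → IsFirstAtomChain s u v c) (sym below-u) c-first)

    straighten-above : ∀ {m′ a′} → AgreesOutside m′ → a′ ∈ m′ → u ⋖ a′ → a′ <ₚ v →
                       ∃[ m₁ ] AgreesOutside m₁ × a′ ∈ m₁ × Ω (r ∪ ⁅ a′ ⁆) a′ v ∈ m₁ × m₁ ⪯ m′
    straighten-above {m′} {a′} agrees a′∈ u⋖a′ a′<v =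
      via (firstAtomChain-exists a′ v (below m′ a′) (<⇒≤ a′<v) (below-root max a′∈))
      where
      open AgreesOutside agrees
      below-a′ : below m′ a′ ≡ r ∪ ⁅ a′ ⁆
      below-a′ = trans (below-⋖ (proj₁ max) u∈m′ a′∈ u⋖a′) (cong (_∪ ⁅ a′ ⁆) below-u)
      via : ∃[ c₁ ] IsFirstAtomChain (below m′ a′) a′ v c₁ →
            ∃[ m₁ ] AgreesOutside m₁ × a′ ∈ m₁ × Ω (r ∪ ⁅ a′ ⁆) a′ v ∈ m₁ × m₁ ⪯ m′
      via (c₁ , c₁-first@(c₁-max , _)) =
        splice m′ a′ c₁ v , agrees₁ , ∈-splice-below a′∈ ≤-refl ,
        ∈-splice-inner {m′} (subst (λ s → Ω s a′ v ∈ c₁) below-a′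
                                   (proj₁ (firstAtomChain-head (below-root max a′∈) a′<v c₁-first))) ,
        IH (⋖⇒< u⋖a′) a′<v max a′∈ v∈m′ c₁-first
        where
        within₁ = proj₁ (proj₂ c₁-max)
        agrees₁ : AgreesOutside (splice m′ a′ c₁ v)
        agrees₁ = record
          { max     = splice-maxChain max a′∈ v∈m′ (<⇒≤ a′<v) c₁-max
          ; u∈m′    = ∈-splice-below u∈m′ (⋖⇒≤ u⋖a′)
          ; v∈m′    = ∈-splice-above v∈m′ ≤-refl
          ; below-u = trans (splice-below within₁ a′∈ (⋖⇒≤ u⋖a′)) below-u
          ; above-v = trans (splice-above within₁ v∈m′ ≤-refl) above-v
          }

    reroute : ∀ {m₁ a′} → AgreesOutside m₁ → a′ ∈ m₁ → Ω (r ∪ ⁅ a′ ⁆) a′ v ∈ m₁ → u ⋖ a′ → a′ <ₚ v →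
              a′ ≢ Ω r u v → Reaches (Ω r u (Ω (r ∪ ⁅ a′ ⁆) a′ v)) → splice m u c v ⪯ m₁
    reroute {m₁} {a′} agrees₁ a′∈m₁ b∈m₁ u⋖a′ a′<v a′≢Ω reaches =
      via (firstAtomChain-exists u b r (<⇒≤ u<b) root)
      where
      open AgreesOutside agrees₁
      b = Ω (r ∪ ⁅ a′ ⁆) a′ v
      a′⋖b = proj₁ (Ω-atom a′<v (root-extend root u⋖a′))
      b≤v = proj₂ (Ω-atom a′<v (root-extend root u⋖a′))
      u<b = <-trans (⋖⇒< u⋖a′) (⋖⇒< a′⋖b)
      descent : IsPseudoDescent m₁ u a′ b
      descent = u∈m′ , a′∈m₁ , b∈m₁ , u⋖a′ , a′⋖b , λ a′≡Ωb →
        a′≢Ω (Equivalence.from (proj₁ (proj₂ (rfas u v r u<v root) a′ (u⋖a′ , <⇒≤ a′<v) a′<v))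
                               (subst (λ s → a′ ≡ Ω s u b) below-u a′≡Ωb))
      via : ∃[ c₂ ] IsFirstAtomChain r u b c₂ → splice m u c v ⪯ m₁
      via (c₂ , c₂-first@(c₂-max , _)) = reaches agrees₂ Ω∈m₂ ◅◅ m₂⟶m₁ ◅ ε
        where
        within₂ = proj₁ (proj₂ c₂-max)
        m₂⟶m₁ : splice m₁ u c₂ b ⟶ m₁
        m₂⟶m₁ = splice-⟶ max descent (subst (λ s → IsFirstAtomChain s u b c₂) (sym below-u) c₂-first)
        agrees₂ : AgreesOutside (splice m₁ u c₂ b)
        agrees₂ = record
          { max     = proj₁ m₂⟶m₁
          ; u∈m′    = ∈-splice-below u∈m′ ≤-refl
          ; v∈m′    = ∈-splice-above v∈m′ b≤v
          ; below-u = trans (splice-below within₂ u∈m′ ≤-refl) below-u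
          ; above-v = trans (splice-above within₂ b∈m₁ b≤v) above-v
          }
        Ω∈m₂ : Ω r u b ∈ splice m₁ u c₂ b
        Ω∈m₂ = ∈-splice-inner {m₁} (proj₁ (firstAtomChain-head root u<b c₂-first))

    detour : ∀ {a′} → u ⋖ a′ → a′ <ₚ v → a′ ≢ Ω r u v → Reaches (Ω r u (Ω (r ∪ ⁅ a′ ⁆) a′ v)) → Reaches a′
    detour u⋖a′ a′<v a′≢Ω reaches agrees a′∈ =
      let (_ , agrees₁ , a′∈m₁ , b∈m₁ , m₁⪯m′) = straighten-above agrees a′∈ u⋖a′ a′<v
      in reroute agrees₁ a′∈m₁ b∈m₁ u⋖a′ a′<v a′≢Ω reaches ◅◅ m₁⪯m′

    -- Walk along the atoms a₁ = Ω r u v, …, a_p of condition (ii), one detour per step.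
    along-chain : ∀ {b} → RFASChain P Ω r u v b → Reaches (Ω r u b)
    along-chain (q , as , bs , atoms , last≡ , first≡ , links) =
      subst Reaches last≡ (<-weakInduction (Reaches ∘ as) (subst Reaches (sym first≡) first-atom-case) step (fromℕ q))
      where
      step : ∀ i → Reaches (as (inject₁ i)) → Reaches (as (suc i))
      step i reaches with as (suc i) ≟ Ω r u v
      ... | yes a≡Ω = subst Reaches (sym a≡Ω) first-atom-case
      ... | no a≢Ω = detour u⋖a (atom<v u⋖a (proj₂ (atoms (suc i))) a≢Ω) a≢Ω (subst Reaches previous reaches)
        where
        u⋖a = proj₁ (atoms (suc i))
        previous : as (inject₁ i) ≡ Ω r u (Ω (r ∪ ⁅ as (suc i) ⁆) (as (suc i)) v)
        previous = trans (proj₂ (links i)) (cong (Ω r u) (proj₁ (links i)))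

    splice⪯ : splice m u c v ⪯ m
    splice⪯ with successor m-max u∈ v∈ u<v
    ... | a , a∈ , u⋖a , a≤v with a ≟ Ω r u v
    ...   | yes a≡Ω = first-atom-case m-agrees (subst (_∈ m) a≡Ω a∈)
    ...   | no a≢Ω = detour u⋖a a<v a≢Ω (along-chain (proj₂ (proj₂ (rfas u v r u<v root) a (u⋖a , a≤v) a<v) a≢Ω))
                            m-agrees a∈
      where
      a<v = atom<v u⋖a a≤v a≢Ω

  splice-firstAtomChain-⪯ : ∀ u → SplicesBelow u
  splice-firstAtomChain-⪯ = upward-induction SplicesBelow λ u IH → SpliceStep.splice⪯ u IH

  splice-between-below : ∀ {m m′ x z} → IsChain m → x ∈ m → z ∈ m → below m x ≡ below m′ x →
                         below m z ≡ below (splice m′ x (between m x z) z) z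
  splice-between-below {m} {m′} {x} {z} chain x∈ z∈ agree = ⊆-antisym ⊆ʳ ⊆ˡ
    where
    ⊆ʳ : below m z ⊆ below (splice m′ x (between m x z) z) z
    ⊆ʳ e∈ with ∈-below⁻ m e∈
    ... | e∈m , e≤z with chain e∈m x∈
    ...   | inj₁ e≤x = ∈-below⁺ (∈-splice-below (proj₁ (∈-below⁻ m′ (subst (_ ∈_) agree (∈-below⁺ e∈m e≤x)))) e≤x) e≤z
    ...   | inj₂ x≤e = ∈-below⁺ (∈-splice-inner {m′} (∈-between⁺ e∈m x≤e e≤z)) e≤z
    ⊆ˡ : below (splice m′ x (between m x z) z) z ⊆ below m z
    ⊆ˡ e∈ with ∈-below⁻ (splice m′ x (between m x z) z) e∈
    ... | e∈s , e≤z with ∈-splice⁻ m′ e∈s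
    ...   | inj₁ (e∈m′ , e≤x) = ∈-below⁺ (proj₁ (∈-below⁻ m (subst (_ ∈_) (sym agree) (∈-below⁺ e∈m′ e≤x)))) e≤z
    ...   | inj₂ (inj₁ e∈b) = ∈-below⁺ (proj₁ (∈-between⁻ m e∈b)) e≤z
    ...   | inj₂ (inj₂ (_ , z≤e)) with antisym e≤z z≤e
    ...     | refl = ∈-below⁺ z∈ ≤-refl

  ∉-splice⇒∉ : ∀ {m m′ x z w} → IsChain m′ → x ∈ m′ → z ∈ m′ → w ∈ m →
               w ∉ splice m′ x (between m x z) z → w ∉ m′
  ∉-splice⇒∉ {m′ = m′} chain x∈ z∈ w∈m w∉s w∈m′ with chain w∈m′ x∈ | chain w∈m′ z∈
  ... | inj₁ w≤x | _        = w∉s (∈-splice-below w∈m′ w≤x)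
  ... | inj₂ _   | inj₂ z≤w = w∉s (∈-splice-above w∈m′ z≤w)
  ... | inj₂ x≤w | inj₁ w≤z = w∉s (∈-splice-inner {m′} (∈-between⁺ w∈m x≤w w≤z))

  PseudoDescentOutside : Subset n → Subset n → Set
  PseudoDescentOutside m m′ = ∃[ x ] ∃[ y ] ∃[ z ] IsPseudoDescent m x y z × y ∉ m′

  DescendsOrPrecedes : Subset n → Fin n → Set
  DescendsOrPrecedes m x = ∀ {m′} → IsMaxChain m′ → x ∈ m → below m x ≡ below m′ x →
                           PseudoDescentOutside m m′ ⊎ m ⪯ m′

  pseudoDescentOutside-or-⪯-from : ∀ {m} → IsMaxChain m → ∀ x → DescendsOrPrecedes m x
  pseudoDescentOutside-or-⪯-from {m} m-max = upward-induction (DescendsOrPrecedes m) step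
    where
    step : ∀ x → (∀ {z} → x <ₚ z → DescendsOrPrecedes m z) → DescendsOrPrecedes m x
    step x IH {m′} m′-max x∈ agree with x ≟ 1̂
    ... | yes refl = inj₂ (subst (m ⪯_) (trans (sym below-1̂) (trans agree below-1̂)) ε)
    ... | no x≢1̂ with least (λ w → (w ∈? m) ×-dec (w ∈? m′) ×-dec (x <? w))
                            (λ e f → proj₁ m-max (proj₁ e) (proj₁ f)) 1̂ (1̂∈ m-max , 1̂∈ m′-max , 1̂-max x , x≢1̂)
    ...   | z , (z∈ , z∈′ , x<z) , z-least with pseudoDescent-or-firstAtomChain m-max x x∈ z∈ (<⇒≤ x<z)
    ...     | inj₁ (p , w , w⁺ , descent@(_ , w∈ , _ , p⋖w , w⋖w⁺ , _) , x≤p , w⁺≤z) =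
                inj₁ (p , w , w⁺ , descent , λ w∈′ →
                  <⇒≱ (<-≤-trans (⋖⇒< w⋖w⁺) w⁺≤z) (z-least w (w∈ , w∈′ , ≤-<-trans x≤p (⋖⇒< p⋖w))))
    ...     | inj₂ segment-first =
                [ inj₁ ∘ descent-outside-N , (λ m⪯N → inj₂ (m⪯N ◅◅ N⪯m′)) ]
                  (IH x<z N-max z∈ (splice-between-below {m′ = m′} (proj₁ m-max) x∈ z∈ agree))
      where
      x∈′ : x ∈ m′
      x∈′ = proj₁ (∈-below⁻ m′ (subst (x ∈_) agree (∈-below⁺ x∈ ≤-refl)))
      N : Subset n
      N = splice m′ x (between m x z) z
      N-max : IsMaxChain N
      N-max = splice-maxChain m′-max x∈′ z∈′ (<⇒≤ x<z) (between-maxChain m-max x∈ z∈)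
      N⪯m′ : N ⪯ m′
      N⪯m′ = splice-firstAtomChain-⪯ x x<z m′-max x∈′ z∈′
               (subst (λ s → IsFirstAtomChain s x z (between m x z)) agree segment-first)
      descent-outside-N : PseudoDescentOutside m N → PseudoDescentOutside m m′
      descent-outside-N (p , w , w⁺ , descent , w∉N) =
        p , w , w⁺ , descent , ∉-splice⇒∉ {m} {m′} {x} {z} (proj₁ m′-max) x∈′ z∈′ (proj₁ (proj₂ descent)) w∉N

  pseudoDescentOutside-or-⪯ : ∀ {m m′} → IsMaxChain m → IsMaxChain m′ → PseudoDescentOutside m m′ ⊎ m ⪯ m′
  pseudoDescentOutside-or-⪯ m-max m′-max =
    pseudoDescentOutside-or-⪯-from m-max 0̂ m′-max (0̂∈ m-max) (trans (below-0̂ m-max) (sym (below-0̂ m′-max)))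

  splice-avoids-descent : ∀ {m x y z c} → IsMaxChain m → IsPseudoDescent m x y z →
                          IsFirstAtomChain (below m x) x z c → y ∉ splice m x c z × m - y ⊆ splice m x c z
  splice-avoids-descent {m} {x} {y} {z} {c} m-max (x∈ , y∈ , z∈ , x⋖y , y⋖z , y≢Ω) c-first = y∉m″ , m-y⊆m″
    where
    x<z = <-trans (⋖⇒< x⋖y) (⋖⇒< y⋖z)
    y∉c : y ∉ c
    y∉c y∈c = let (Ω∈c , x⋖Ω) = firstAtomChain-head (below-root m-max x∈) x<z c-first
              in y≢Ω (chain-⋖-unique (proj₁ (proj₁ c-first)) y∈c Ω∈c x⋖y x⋖Ω)
    y∉m″ : y ∉ splice m x c z
    y∉m″ y∈m″ with ∈-splice⁻ m y∈m″
    ... | inj₁ (_ , y≤x)        = <⇒≱ (⋖⇒< x⋖y) y≤x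
    ... | inj₂ (inj₁ y∈c)       = y∉c y∈c
    ... | inj₂ (inj₂ (_ , z≤y)) = <⇒≱ (⋖⇒< y⋖z) z≤y
    m-y⊆m″ : m - y ⊆ splice m x c z
    m-y⊆m″ {w} w∈ = [ ∈-splice-below w∈m , (λ y≤w → [ ⊥-elim ∘ w≢y ∘ flip antisym y≤w , ∈-splice-above w∈m ]
                                                  (chain-⋖-split (proj₁ m-max) y∈ z∈ y⋖z w∈m)) ]
                        (chain-⋖-split (proj₁ m-max) x∈ y∈ x⋖y w∈m)
      where
      w∈m : w ∈ m
      w∈m = p─q⊆p m ⁅ y ⁆ w∈
      w≢y : w ≢ y
      w≢y refl = x∉p-x {p = m} w∈

  pseudoDescent-flip : ∀ {m x y z} → IsMaxChain m → IsPseudoDescent m x y z →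
                       ∃[ m″ ] IsMaxChain m″ × m″ ⪯ m × y ∉ m″ × m - y ⊆ m″
  pseudoDescent-flip {m} {x} {y} {z} m-max descent@(x∈ , _ , _ , x⋖y , y⋖z , _) =
    flip-with (firstAtomChain-exists x z (below m x) (≤-trans (⋖⇒≤ x⋖y) (⋖⇒≤ y⋖z)) (below-root m-max x∈))
    where
    flip-with : ∃[ c ] IsFirstAtomChain (below m x) x z c → ∃[ m″ ] IsMaxChain m″ × m″ ⪯ m × y ∉ m″ × m - y ⊆ m″
    flip-with (c , c-first) = splice m x c z , proj₁ step , step ◅ ε , splice-avoids-descent m-max descent c-first
      where
      step : splice m x c z ⟶ m
      step = splice-⟶ m-max descent c-first

  linearExtension-exchange : ∀ {s F} → IsLinearExtension P Ω s F → ∀ {i j} → i Fin.< j →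
                             ∃[ y ] y ∈ F j × y ∉ F i × ∃[ k ] k Fin.< j × F j - y ⊆ F k
  linearExtension-exchange {s} {F} (max , onto , _ , monotone) {i} {j} i<j =
    [ exchange , (λ Fj⪯Fi → ⊥-elim (ℕ.<⇒≱ i<j (monotone j i Fj⪯Fi))) ] (pseudoDescentOutside-or-⪯ (max j) (max i))
    where
    exchange : PseudoDescentOutside (F j) (F i) → ∃[ y ] y ∈ F j × y ∉ F i × ∃[ k ] k Fin.< j × F j - y ⊆ F k
    exchange (_ , y , _ , descent , y∉Fi) = flipped (pseudoDescent-flip (max j) descent)
      where
      y∈Fj = proj₁ (proj₂ descent)
      flipped : ∃[ m″ ] IsMaxChain m″ × m″ ⪯ F j × y ∉ m″ × F j - y ⊆ m″ →
                ∃[ y ] y ∈ F j × y ∉ F i × ∃[ k ] k Fin.< j × F j - y ⊆ F k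
      flipped (m″ , m″-max , m″⪯Fj , y∉m″ , Fj-y⊆m″) with onto m″ m″-max
      ... | k , refl = y , y∈Fj , y∉Fi , k , ≤∧≢⇒< (monotone k j m″⪯Fj) (λ { refl → y∉m″ y∈Fj }) , Fj-y⊆m″

module LengthOne {n : ℕ} (P : FinBoundedPoset n) (length-1 : HasLength P 1) where
  open Chains P

  maxChain≡⁅0̂,1̂⁆ : ∀ {m} → IsMaxChain m → m ≡ ⁅ 0̂ ⁆ ∪ ⁅ 1̂ ⁆
  maxChain≡⁅0̂,1̂⁆ {m} m-max = ⊆-antisym only-ends ends⊆m
    where
    ends⊆m : ⁅ 0̂ ⁆ ∪ ⁅ 1̂ ⁆ ⊆ m
    ends⊆m w∈ = [ (λ w∈0̂ → subst (_∈ m) (sym (x∈⁅y⁆⇒x≡y 0̂ w∈0̂)) (0̂∈ m-max))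
                , (λ w∈1̂ → subst (_∈ m) (sym (x∈⁅y⁆⇒x≡y 1̂ w∈1̂)) (1̂∈ m-max)) ] (∈-∪⁻ w∈)
    only-ends : m ⊆ ⁅ 0̂ ⁆ ∪ ⁅ 1̂ ⁆
    only-ends {w} w∈ with w ≟ 0̂ | w ≟ 1̂
    ... | yes refl | _        = ∈-∪ˡ (x∈⁅x⁆ 0̂)
    ... | no _     | yes refl = ∈-∪ʳ (x∈⁅x⁆ 1̂)
    ... | no w≢0̂   | no w≢1̂   = ⊥-elim (ℕ.<⇒≱ three≤∣m∣ (proj₂ length-1 m (proj₁ m-max)))
      where
      0̂≢1̂ : 0̂ ≢ 1̂
      0̂≢1̂ 0̂≡1̂ = w≢0̂ (antisym (subst (w ≤_) (sym 0̂≡1̂) (1̂-max w)) (0̂-min w))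
      ends⊂ : ⁅ 0̂ ⁆ ⊂ ⁅ 0̂ ⁆ ∪ ⁅ 1̂ ⁆
      ends⊂ = ∈-∪ˡ , 1̂ , ∈-∪ʳ (x∈⁅x⁆ 1̂) , 0̂≢1̂ ∘ sym ∘ x∈⁅y⁆⇒x≡y 0̂
      w⊂ : ⁅ 0̂ ⁆ ∪ ⁅ 1̂ ⁆ ⊂ (⁅ 0̂ ⁆ ∪ ⁅ 1̂ ⁆) ∪ ⁅ w ⁆
      w⊂ = ∈-∪ˡ , w , ∈-∪ʳ (x∈⁅x⁆ w) , [ w≢0̂ ∘ x∈⁅y⁆⇒x≡y 0̂ , w≢1̂ ∘ x∈⁅y⁆⇒x≡y 1̂ ] ∘ ∈-∪⁻
      S⊆m : (⁅ 0̂ ⁆ ∪ ⁅ 1̂ ⁆) ∪ ⁅ w ⁆ ⊆ m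
      S⊆m v∈ = [ ends⊆m , (λ v∈w → subst (_∈ m) (sym (x∈⁅y⁆⇒x≡y w v∈w)) w∈) ] (∈-∪⁻ v∈)
      three≤∣m∣ : 2 ℕ.< ∣ m ∣
      three≤∣m∣ = ℕ.<-≤-trans (ℕ.≤-<-trans (ℕ.≤-<-trans (ℕ.≤-reflexive (sym (∣⁅x⁆∣≡1 0̂))) (p⊂q⇒∣p∣<∣q∣ ends⊂))
                                           (p⊂q⇒∣p∣<∣q∣ w⊂))
                              (p⊆q⇒∣p∣≤∣q∣ S⊆m)

  linearExtension-trivial : ∀ {Ω s F} → IsLinearExtension P Ω s F → ∀ {i j} → i Fin.< j → ⊥
  linearExtension-trivial (max , _ , injective , _) {i} {j} i<j =
    ℕ.<-irrefl (cong toℕ (injective i j (trans (maxChain≡⁅0̂,1̂⁆ (max i)) (sym (maxChain≡⁅0̂,1̂⁆ (max j)))))) i<j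

theorem5p13 : ∀ {n : ℕ} (P : FinBoundedPoset n)
                (Ω : Subset n → Fin n → Fin n → Fin n) →
                IsRFAS P Ω →
                (s : ℕ) (F : Fin s → Subset n) →
                IsLinearExtension P Ω s F →
                IsShellingOrder F
theorem5p13 P Ω (inj₁ length-1) s F extension =
  shelling-criterion F (⊥-elim ∘ LengthOne.linearExtension-trivial P length-1 {Ω} extension)
theorem5p13 P Ω (inj₂ rfas) s F extension =
  shelling-criterion F (Ordering.linearExtension-exchange P Ω rfas extension)
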